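{- Let $G$ be a hypo-unique domination graph. Then either $G=K_2$, or $G$ is a connected vertex domination-critical graph with $|V(G)|\geq 4$.
   Context: All graphs are finite, simple and undirected. A dominating set of $G$ is a set $D\subseteq V(G)$ such that every vertex not in $D$ has a neighbor in $D$; $\gamma(G)$ is the minimum size of a dominating set, and a dominating set of size $\gamma(G)$ is a $\gamma$-set. A vertex $v$ is $\gamma$-critical if $\gamma(G-v)<\gamma(G)$; $G$ is a vertex domination-critical graph (vc-graph) if every vertex of $G$ is $\gamma$-critical. A graph $G$ is a hypo-unique domination graph (hypo-$\mathcal{UD}$ graph) if $G$ has at least two distinct $\gamma$-sets, but for every $v\in V(G)$ the graph $G-v$ has exactly one $\gamma$-set. -}

module Defs where

open import Data.Nat using (ℕ; zero; suc; _≤_; _<_; pred)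
open import Data.Fin using (Fin; punchIn)
open import Data.Fin.Subset using (Subset; _∈_; _∉_; ∣_∣)
open import Data.Bool using (Bool; true; false)
open import Data.Product using (Σ; ∃; ∃-syntax; _×_; _,_)
open import Data.Unit using (⊤)
open import Relation.Binary.PropositionalEquality using (_≡_; _≢_)

record Graph (n : ℕ) : Set where
  field
    Adj    : Fin n → Fin n → Bool
    sym    : ∀ i j → Adj i j ≡ Adj j i
    irrefl : ∀ i → Adj i i ≡ false
open Graph public

-- Vertex deletion G - v: the induced subgraph on V(G) ∖ {v},
-- vertices of G - v are relabelled by Fin m via punchIn v.
_─_ : ∀ {m} → Graph (suc m) → Fin (suc m) → Graph m
Adj (G ─ v) i j = Adj G (punchIn v i) (punchIn v j)
sym (G ─ v) i j = sym G (punchIn v i) (punchIn v j)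
irrefl (G ─ v) i = irrefl G (punchIn v i)

ForAllDeletions : ∀ {n} → Graph n → (∀ {m} → Graph m → Set) → Set
ForAllDeletions {zero}  G P = ⊤
ForAllDeletions {suc m} G P = ∀ (v : Fin (suc m)) → P (G ─ v)

Dominating : ∀ {n} → Graph n → Subset n → Set
Dominating G D = ∀ u → u ∉ D → ∃[ w ] (w ∈ D × Adj G u w ≡ true)

-- γ(G) = k  (the domination number; it always exists since V(G) dominates).
DomNumber : ∀ {n} → Graph n → ℕ → Set
DomNumber G k = (∃[ D ] (Dominating G D × ∣ D ∣ ≡ k))
              × (∀ D → Dominating G D → k ≤ ∣ D ∣)

GammaSet : ∀ {n} → Graph n → Subset n → Set
GammaSet G D = Dominating G D × (∀ D′ → Dominating G D′ → ∣ D ∣ ≤ ∣ D′ ∣)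

UniqueGammaSet : ∀ {n} → Graph n → Set
UniqueGammaSet G = ∃[ D ] (GammaSet G D × (∀ D′ → GammaSet G D′ → D′ ≡ D))

TwoGammaSets : ∀ {n} → Graph n → Set
TwoGammaSets G = ∃[ D ] ∃[ D′ ] (GammaSet G D × GammaSet G D′ × D ≢ D′)

HypoUD : ∀ {n} → Graph n → Set
HypoUD G = TwoGammaSets G × ForAllDeletions G UniqueGammaSet

GammaCritical : ∀ {m} → Graph (suc m) → Fin (suc m) → Set
GammaCritical G v = ∀ k k′ → DomNumber G k → DomNumber (G ─ v) k′ → k′ < k

VC : ∀ {n} → Graph n → Set
VC {zero}  G = ⊤
VC {suc m} G = ∀ v → GammaCritical G v

data Reachable {n} (G : Graph n) : Fin n → Fin n → Set where
  here : ∀ {u} → Reachable G u u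
  step : ∀ {u w x} → Adj G u w ≡ true → Reachable G w x → Reachable G u x

Connected : ∀ {n} → Graph n → Set
Connected G = ∀ u w → Reachable G u w

IsK₂ : ∀ {n} → Graph n → Set
IsK₂ {n} G = (n ≡ 2) × (∀ u w → u ≢ w → Adj G u w ≡ true)

module Submission where

-- A vertex v is critical when the unique γ-set S v of G - v, read as a subset of V(G) avoiding v,
-- is smaller than γ(G). If v is not critical, every γ-set of G avoiding v is a γ-set of G - v, so
-- there is at most one such set; this rigidity drives the whole argument.
-- Connectivity: if a closed set X (a union of components) misses w, exchanging a γ-set T with S w
-- on X yields a dominating set of G - w no larger than S w, hence equal to it; so every γ-set agrees
-- with S w on X, and a closed set together with its complement would make all γ-sets equal.
-- Criticality: a noncritical x with a critical neighbour ℓ forces xℓ to be an isolated edge which no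
-- S y meets, so V(G) = {x, ℓ}; if no vertex is critical, the private neighbours of two distinct
-- γ-sets again leave room for two vertices only. So for n ≥ 3 every vertex is critical, whence
-- γ ≥ 2, excluding n = 3, where a connected graph has a dominating vertex. For n ≤ 2 two γ-sets force
-- an edge, since in an edgeless graph only V(G) dominates.


open import Defs hiding (sym)
open import Data.Nat using (ℕ; zero; suc; _+_; _≤_; _<_; _<?_; z≤n; s≤s)
open import Data.Nat.Properties
  using (≤-trans; ≤-antisym; ≤-reflexive; <⇒≱; ≤-<-trans; m≤n⇒m≤1+n; +-suc; +-comm; m≤m+n;
         +-monoʳ-≤; +-cancelˡ-≤; ≤-<-connex; ≮⇒≥; module ≤-Reasoning)
open import Data.Fin using (Fin; zero; suc; punchIn; punchOut)
open import Data.Fin.Properties using (_≟_; any?; all?; punchIn-punchOut; punchInᵢ≢i; 0≢1+n)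
  renaming (suc-injective to Fin-suc-injective)
open import Data.Fin.Subset
  using (Subset; inside; outside; _∈_; _∉_; _⊆_; _∪_; _-_; ⁅_⁆; ∁; ∣_∣)
open import Data.Fin.Subset.Properties
  using (_∈?_; p⊆q⇒∣p∣≤∣q∣; p⊂q⇒∣p∣<∣q∣; drop-∷-⊆; ⊆-antisym; ∣p∣≤n; p⊆p∪q; q⊆p∪q; x∈p∪q⁻;
         x∈⁅x⁆; x∈⁅y⁆⇒x≡y; x∉⁅y⁆⇒x≢y; ∣⁅x⁆∣≡1; p─q⊆p; x∈p∧x≢y⇒x∈p-y; x∈p⇒∣p-x∣<∣p∣;
         x∈∁p⇒x∉p; x∉p⇒x∈∁p; x∈p⇒x∉∁p)
open import Data.Bool using (true; false)
open import Data.Bool.Properties using () renaming (_≟_ to _≟ᵇ_)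
open import Data.Vec using (_∷_; []; here; there; lookup; insertAt; removeAt)
open import Data.Vec.Properties
  using ([]=⇒lookup; lookup⇒[]=; insertAt-lookup; insertAt-punchIn; insertAt-removeAt)
open import Data.Product using (∃-syntax; _×_; _,_; proj₁; proj₂)
open import Data.Sum using (_⊎_; inj₁; inj₂)
import Data.Sum as Sum
open import Data.Empty using (⊥-elim)
open import Function using (_∘_; id)
open import Relation.Nullary using (¬_; Dec; yes; no; contradiction)
open import Relation.Nullary.Decidable using (_×-dec_; _→-dec_; ¬?)
open import Relation.Binary.PropositionalEquality
  using (_≡_; _≢_; refl; sym; trans; cong; subst; subst₂)

private variable
  m n : ℕ
  p q : Subset n
  x y : Fin n

∉⇒lookup≡outside : ∀ (p : Subset n) {x} → x ∉ p → lookup p x ≡ outside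
∉⇒lookup≡outside p {x} x∉p with lookup p x in eq
... | inside  = contradiction (lookup⇒[]= x p eq) x∉p
... | outside = refl

∈-resp-lookup : ∀ {p : Subset n} {q : Subset m} {x y} → lookup p x ≡ lookup q y → x ∈ p → y ∈ q
∈-resp-lookup {q = q} {y = y} eq x∈p = lookup⇒[]= y q (trans (sym eq) ([]=⇒lookup x∈p))

x∉p-x : ∀ (p : Subset n) x → x ∉ p - x
x∉p-x (_ ∷ p) zero    ()
x∉p-x (_ ∷ p) (suc x) (there x∈p-x) = x∉p-x p x x∈p-x

x∈p-y⇒x∈p : x ∈ p - y → x ∈ p
x∈p-y⇒x∈p {p = p} {y = y} = p─q⊆p p ⁅ y ⁆

x∈p∪⁅x⁆ : ∀ (p : Subset n) x → x ∈ p ∪ ⁅ x ⁆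
x∈p∪⁅x⁆ p x = q⊆p∪q p ⁅ x ⁆ (x∈⁅x⁆ x)

x∈p⇒1≤∣p∣ : x ∈ p → 1 ≤ ∣ p ∣
x∈p⇒1≤∣p∣ {x = x} x∈p = ≤-trans (≤-reflexive (sym (∣⁅x⁆∣≡1 x)))
  (p⊆q⇒∣p∣≤∣q∣ λ y∈⁅x⁆ → subst (_∈ _) (sym (x∈⁅y⁆⇒x≡y x y∈⁅x⁆)) x∈p)

x∈p∪⁅y⁆⁻ : ∀ (p : Subset n) y → x ∈ p ∪ ⁅ y ⁆ → x ∈ p ⊎ x ≡ y
x∈p∪⁅y⁆⁻ p y = Sum.map₂ (x∈⁅y⁆⇒x≡y y) ∘ x∈p∪q⁻ p ⁅ y ⁆

x∉p∪⁅y⁆ : ∀ (p : Subset n) y → x ∉ p → x ≢ y → x ∉ p ∪ ⁅ y ⁆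
x∉p∪⁅y⁆ p y x∉p x≢y x∈ = Sum.[ x∉p , x≢y ] (x∈p∪⁅y⁆⁻ p y x∈)

∣p∪q∣≤∣p∣+∣q∣ : ∀ (p q : Subset n) → ∣ p ∪ q ∣ ≤ ∣ p ∣ + ∣ q ∣
∣p∪q∣≤∣p∣+∣q∣ []            []            = z≤n
∣p∪q∣≤∣p∣+∣q∣ (outside ∷ p) (outside ∷ q) = ∣p∪q∣≤∣p∣+∣q∣ p q
∣p∪q∣≤∣p∣+∣q∣ (inside  ∷ p) (outside ∷ q) = s≤s (∣p∪q∣≤∣p∣+∣q∣ p q)
∣p∪q∣≤∣p∣+∣q∣ (outside ∷ p) (inside  ∷ q) =
  ≤-trans (s≤s (∣p∪q∣≤∣p∣+∣q∣ p q)) (≤-reflexive (sym (+-suc ∣ p ∣ ∣ q ∣)))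
∣p∪q∣≤∣p∣+∣q∣ (inside  ∷ p) (inside  ∷ q) =
  s≤s (≤-trans (m≤n⇒m≤1+n (∣p∪q∣≤∣p∣+∣q∣ p q)) (≤-reflexive (sym (+-suc ∣ p ∣ ∣ q ∣))))

∣p∪⁅x⁆∣≤1+∣p∣ : ∀ (p : Subset n) x → ∣ p ∪ ⁅ x ⁆ ∣ ≤ suc ∣ p ∣
∣p∪⁅x⁆∣≤1+∣p∣ p x = ≤-trans (∣p∪q∣≤∣p∣+∣q∣ p ⁅ x ⁆)
  (≤-reflexive (trans (cong (∣ p ∣ +_) (∣⁅x⁆∣≡1 x)) (+-comm ∣ p ∣ 1)))

∣p-x∪⁅y⁆∣≤∣p∣ : ∀ (p : Subset n) y → x ∈ p → ∣ (p - x) ∪ ⁅ y ⁆ ∣ ≤ ∣ p ∣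
∣p-x∪⁅y⁆∣≤∣p∣ {x = x} p y x∈p = ≤-trans (∣p∪⁅x⁆∣≤1+∣p∣ (p - x) y) (x∈p⇒∣p-x∣<∣p∣ x∈p)

⊆∧∣⊇∣⇒≡ : p ⊆ q → ∣ q ∣ ≤ ∣ p ∣ → p ≡ q
⊆∧∣⊇∣⇒≡ {p = []}          {[]}          _   _  = refl
⊆∧∣⊇∣⇒≡ {p = outside ∷ p} {outside ∷ q} p⊆q le = cong (outside ∷_) (⊆∧∣⊇∣⇒≡ (drop-∷-⊆ p⊆q) le)
⊆∧∣⊇∣⇒≡ {p = inside  ∷ p} {inside  ∷ q} p⊆q (s≤s le) = cong (inside ∷_) (⊆∧∣⊇∣⇒≡ (drop-∷-⊆ p⊆q) le)
⊆∧∣⊇∣⇒≡ {p = outside ∷ p} {inside  ∷ q} p⊆q le =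
  contradiction le (<⇒≱ (s≤s (p⊆q⇒∣p∣≤∣q∣ (drop-∷-⊆ p⊆q))))
⊆∧∣⊇∣⇒≡ {p = inside  ∷ p} {outside ∷ q} p⊆q _  = contradiction (p⊆q here) λ ()

∣q∣≤∣p∣∧p≢q⇒∃p-q : ∣ q ∣ ≤ ∣ p ∣ → p ≢ q → ∃[ x ] (x ∈ p × x ∉ q)
∣q∣≤∣p∣∧p≢q⇒∃p-q {q = q} {p = p} le p≢q with any? (λ x → x ∈? p ×-dec ¬? (x ∈? q))
... | yes witness = witness
... | no  none    = contradiction (⊆∧∣⊇∣⇒≡ p⊆q le) p≢q
  where
  p⊆q : p ⊆ q
  p⊆q {x} x∈p with x ∈? q
  ... | yes x∈q = x∈q
  ... | no  x∉q = contradiction (x , x∈p , x∉q) none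

injection⇒∣p∣≤∣q∣ : ∀ (p : Subset n) {q : Subset m} (f : Fin n → Fin m) →
                    (∀ {x} → x ∈ p → f x ∈ q) →
                    (∀ {x y} → x ∈ p → y ∈ p → f x ≡ f y → x ≡ y) → ∣ p ∣ ≤ ∣ q ∣
injection⇒∣p∣≤∣q∣ []            f _    _   = z≤n
injection⇒∣p∣≤∣q∣ (outside ∷ p) f maps inj =
  injection⇒∣p∣≤∣q∣ p (f ∘ suc) (maps ∘ there) λ x∈p y∈p → Fin-suc-injective ∘ inj (there x∈p) (there y∈p)
injection⇒∣p∣≤∣q∣ (inside  ∷ p) {q} f maps inj = ≤-trans (s≤s ∣p∣≤∣q-f0∣) (x∈p⇒∣p-x∣<∣p∣ (maps here))
  where
  maps′ : ∀ {x} → x ∈ p → f (suc x) ∈ q - f zero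
  maps′ x∈p = x∈p∧x≢y⇒x∈p-y (maps (there x∈p)) (λ eq → 0≢1+n (inj here (there x∈p) (sym eq)))
  ∣p∣≤∣q-f0∣ : ∣ p ∣ ≤ ∣ q - f zero ∣
  ∣p∣≤∣q-f0∣ = injection⇒∣p∣≤∣q∣ p (f ∘ suc) maps′ λ x∈p y∈p → Fin-suc-injective ∘ inj (there x∈p) (there y∈p)

∣insertAt-outside∣ : ∀ (p : Subset n) i → ∣ insertAt p i outside ∣ ≡ ∣ p ∣
∣insertAt-outside∣ p             zero    = refl
∣insertAt-outside∣ (inside  ∷ p) (suc i) = cong suc (∣insertAt-outside∣ p i)
∣insertAt-outside∣ (outside ∷ p) (suc i) = ∣insertAt-outside∣ p i

select : Subset n → Subset n → Subset n → Subset n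
select []            []      []      = []
select (inside  ∷ X) (a ∷ P) (_ ∷ Q) = a ∷ select X P Q
select (outside ∷ X) (_ ∷ P) (b ∷ Q) = b ∷ select X P Q

select-inside : ∀ X P Q {x : Fin n} → x ∈ X → lookup (select X P Q) x ≡ lookup P x
select-inside (inside  ∷ X) (a ∷ P) (b ∷ Q) here        = refl
select-inside (inside  ∷ X) (a ∷ P) (b ∷ Q) (there x∈X) = select-inside X P Q x∈X
select-inside (outside ∷ X) (a ∷ P) (b ∷ Q) (there x∈X) = select-inside X P Q x∈X

select-outside : ∀ X P Q {x : Fin n} → x ∉ X → lookup (select X P Q) x ≡ lookup Q x
select-outside (inside  ∷ X) (a ∷ P) (b ∷ Q) {zero}  x∉X = contradiction here x∉X
select-outside (outside ∷ X) (a ∷ P) (b ∷ Q) {zero}  x∉X = refl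
select-outside (inside  ∷ X) (a ∷ P) (b ∷ Q) {suc x} x∉X = select-outside X P Q (x∉X ∘ there)
select-outside (outside ∷ X) (a ∷ P) (b ∷ Q) {suc x} x∉X = select-outside X P Q (x∉X ∘ there)

∣∷∣+∣∷∣-cong : ∀ a b (p q p′ q′ : Subset n) → ∣ p ∣ + ∣ q ∣ ≡ ∣ p′ ∣ + ∣ q′ ∣ →
               ∣ a ∷ p ∣ + ∣ b ∷ q ∣ ≡ ∣ a ∷ p′ ∣ + ∣ b ∷ q′ ∣
∣∷∣+∣∷∣-cong outside outside _ _ _  _  eq = eq
∣∷∣+∣∷∣-cong inside  outside _ _ _  _  eq = cong suc eq
∣∷∣+∣∷∣-cong outside inside  p q p′ q′ eq =
  trans (+-suc ∣ p ∣ ∣ q ∣) (trans (cong suc eq) (sym (+-suc ∣ p′ ∣ ∣ q′ ∣)))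
∣∷∣+∣∷∣-cong inside  inside  p q p′ q′ eq = cong suc (∣∷∣+∣∷∣-cong outside inside p q p′ q′ eq)

∣select∣+∣select∣ : ∀ (X P Q : Subset n) → ∣ select X P Q ∣ + ∣ select X Q P ∣ ≡ ∣ P ∣ + ∣ Q ∣
∣select∣+∣select∣ []            []      []      = refl
∣select∣+∣select∣ (inside  ∷ X) (a ∷ P) (b ∷ Q) =
  ∣∷∣+∣∷∣-cong a b (select X P Q) (select X Q P) P Q (∣select∣+∣select∣ X P Q)
∣select∣+∣select∣ (outside ∷ X) (a ∷ P) (b ∷ Q) =
  trans (+-comm ∣ b ∷ select X P Q ∣ ∣ a ∷ select X Q P ∣)
        (∣∷∣+∣∷∣-cong a b (select X Q P) (select X P Q) P Q
          (trans (+-comm ∣ select X Q P ∣ ∣ select X P Q ∣) (∣select∣+∣select∣ X P Q)))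

module Neighbourhoods {n : ℕ} (G : Graph n) where

  infix 4 _~_
  _~_ : Fin n → Fin n → Set
  u ~ w = Adj G u w ≡ true

  _~?_ : ∀ u w → Dec (u ~ w)
  u ~? w = Adj G u w ≟ᵇ true

  ~-sym : ∀ {u w} → u ~ w → w ~ u
  ~-sym {u} {w} u~w = trans (Graph.sym G w u) u~w

  ~-irrefl : ∀ {u w} → u ~ w → u ≢ w
  ~-irrefl {u} u~u refl with trans (sym u~u) (irrefl G u)
  ... | ()

  universal⇒dominating : ∀ {c} → (∀ u → u ≢ c → u ~ c) → Dominating G ⁅ c ⁆
  universal⇒dominating {c} adjacent u u∉⁅c⁆ = c , x∈⁅x⁆ c , adjacent u (x∉⁅y⁆⇒x≢y u∉⁅c⁆)

  isolated⇒unreachable : ∀ {a b} → a ≢ b → (∀ w → Adj G a w ≡ false) → ¬ Reachable G a b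
  isolated⇒unreachable a≢b _            here          = a≢b refl
  isolated⇒unreachable _   no-neighbour (step {w = w} a~w _) with trans (sym a~w) (no-neighbour w)
  ... | ()

  DominatesExcept : Fin n → Subset n → Set
  DominatesExcept v D = ∀ u → u ≢ v → u ∉ D → ∃[ w ] (w ∈ D × u ~ w)

  dominating⇒dominatesExcept : ∀ {D} v → Dominating G D → DominatesExcept v D
  dominating⇒dominatesExcept v dom u _ = dom u

  dominatesExcept-mono : ∀ {v D D′} → D ⊆ D′ → DominatesExcept v D → DominatesExcept v D′
  dominatesExcept-mono D⊆D′ dom u u≢v u∉D′ with dom u u≢v (u∉D′ ∘ D⊆D′)
  ... | w , w∈D , u~w = w , D⊆D′ w∈D , u~w

  dominatesExcept⇒dominating : ∀ {v D} → (v ∉ D → ∃[ w ] (w ∈ D × v ~ w)) →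
                               DominatesExcept v D → Dominating G D
  dominatesExcept⇒dominating {v} v-dominated dom u u∉D with u ≟ v
  ... | yes refl = v-dominated u∉D
  ... | no  u≢v  = dom u u≢v u∉D

  Private : Subset n → Fin n → Fin n → Set
  Private D z q = q ∉ D × q ~ z × (∀ w → w ∈ D → q ~ w → w ≡ z)

  private? : ∀ D z q → Dec (Private D z q)
  private? D z q = ¬? (q ∈? D) ×-dec q ~? z ×-dec all? (λ w → w ∈? D →-dec q ~? w →-dec w ≟ z)

  private-unique : ∀ {D z z′ q} → Private D z q → Private D z′ q → z ∈ D → z ≡ z′
  private-unique (_ , q~z , _) (_ , _ , only′) z∈D = only′ _ z∈D q~z

  dominator-after-removal : ∀ {D y u} → u ≢ y → u ∉ D - y → (u ∉ D → ∃[ w ] (w ∈ D × u ~ w)) →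
                            (∃[ w ] (w ∈ D - y × u ~ w)) ⊎ Private D y u
  dominator-after-removal {D} {y} {u} u≢y u∉D-y dominated
    with any? (λ w → w ∈? D ×-dec ¬? (w ≟ y) ×-dec u ~? w)
  ... | yes (w , w∈D , w≢y , u~w) = inj₁ (w , x∈p∧x≢y⇒x∈p-y w∈D w≢y , u~w)
  ... | no  none = inj₂ (u∉D , u~y , only)
    where
    u∉D : u ∉ D
    u∉D u∈D = u∉D-y (x∈p∧x≢y⇒x∈p-y u∈D u≢y)
    only : ∀ w → w ∈ D → u ~ w → w ≡ y
    only w w∈D u~w with w ≟ y
    ... | yes w≡y = w≡y
    ... | no  w≢y = contradiction (w , w∈D , w≢y , u~w) none
    u~y : u ~ y
    u~y with dominated u∉D
    ... | w , w∈D , u~w = subst (u ~_) (only w w∈D u~w) u~w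

  remove-dominates : ∀ {v D y} → DominatesExcept v D →
                     (y ≢ v → ∃[ w ] (w ∈ D - y × y ~ w)) →
                     (∀ u → u ≢ v → ¬ Private D y u) → DominatesExcept v (D - y)
  remove-dominates {v} {D} {y} dom y-dominated no-private u u≢v u∉D-y with u ≟ y
  ... | yes refl = y-dominated u≢v
  ... | no  u≢y with dominator-after-removal u≢y u∉D-y (dom u u≢v)
  ...   | inj₁ dominator = dominator
  ...   | inj₂ private-u = contradiction private-u (no-private u u≢v)

  swap-dominates : ∀ {v D y q} → DominatesExcept v D → y ~ q →
                   (∀ u → u ≢ v → Private D y u → u ≡ q ⊎ u ~ q) →
                   DominatesExcept v ((D - y) ∪ ⁅ q ⁆)
  swap-dominates {v} {D} {y} {q} dom y~q private-near-q u u≢v u∉D′ with u ≟ y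
  ... | yes refl = q , x∈p∪⁅x⁆ (D - y) q , y~q
  ... | no  u≢y with dominator-after-removal u≢y (u∉D′ ∘ p⊆p∪q ⁅ q ⁆) (dom u u≢v)
  ...   | inj₁ (w , w∈D-y , u~w) = w , p⊆p∪q ⁅ q ⁆ w∈D-y , u~w
  ...   | inj₂ private-u with private-near-q u u≢v private-u
  ...     | inj₁ refl = contradiction (x∈p∪⁅x⁆ (D - y) u) u∉D′
  ...     | inj₂ u~q  = q , x∈p∪⁅x⁆ (D - y) q , u~q

  Closed : Subset n → Set
  Closed X = ∀ {a b} → a ∈ X → a ~ b → b ∈ X

  ∁-closed : ∀ {X} → Closed X → Closed (∁ X)
  ∁-closed closed a∈∁X a~b = x∉p⇒x∈∁p λ b∈X → x∈∁p⇒x∉p a∈∁X (closed b∈X (~-sym a~b))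

  select-dominator : ∀ {X P Q u} → Closed X → u ∉ select X P Q →
                     (u ∈ X → u ∉ P → ∃[ z ] (z ∈ P × u ~ z)) →
                     (u ∉ X → u ∉ Q → ∃[ z ] (z ∈ Q × u ~ z)) →
                     ∃[ z ] (z ∈ select X P Q × u ~ z)
  select-dominator {X} {P} {Q} {u} closed u∉ inside-dominated outside-dominated with u ∈? X
  ... | yes u∈X with inside-dominated u∈X (u∉ ∘ ∈-resp-lookup (sym (select-inside X P Q u∈X)))
  ...   | z , z∈P , u~z = z , ∈-resp-lookup (sym (select-inside X P Q (closed u∈X u~z))) z∈P , u~z
  select-dominator {X} {P} {Q} {u} closed u∉ inside-dominated outside-dominated | no u∉X
    with outside-dominated u∉X (u∉ ∘ ∈-resp-lookup (sym (select-outside X P Q u∉X)))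
  ...   | z , z∈Q , u~z = z , ∈-resp-lookup (sym (select-outside X P Q z∉X)) z∈Q , u~z
    where
    z∉X : z ∉ X
    z∉X z∈X = u∉X (closed z∈X (~-sym u~z))

  reachable-snoc : ∀ {u w z} → Reachable G u w → w ~ z → Reachable G u z
  reachable-snoc here         w~z = step w~z here
  reachable-snoc (step u~a r) w~z = step u~a (reachable-snoc r w~z)

  component : ∀ u → ∃[ X ] (u ∈ X × Closed X × (∀ {y} → y ∈ X → Reachable G u y))
  component u = grow n ⁅ u ⁆ (m≤m+n n _) (x∈⁅x⁆ u)
                  λ y∈⁅u⁆ → subst (Reachable G u) (sym (x∈⁅y⁆⇒x≡y u y∈⁅u⁆)) here
    where
    -- Each round adds a vertex, so the fuel n − ∣ R ∣ suffices.
    grow : ∀ fuel R → n ≤ fuel + ∣ R ∣ → u ∈ R → (∀ {y} → y ∈ R → Reachable G u y) →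
           ∃[ X ] (u ∈ X × Closed X × (∀ {y} → y ∈ X → Reachable G u y))
    grow fuel R bound u∈R reach with any? (λ a → any? (λ b → a ∈? R ×-dec a ~? b ×-dec ¬? (b ∈? R)))
    ... | no none = R , u∈R , closed , reach
      where
      closed : Closed R
      closed {a} {b} a∈R a~b with b ∈? R
      ... | yes b∈R = b∈R
      ... | no  b∉R = contradiction (a , b , a∈R , a~b , b∉R) none
    ... | yes (a , b , a∈R , a~b , b∉R) = grow′ fuel bound
      where
      R′ = R ∪ ⁅ b ⁆
      R<R′ : ∣ R ∣ < ∣ R′ ∣
      R<R′ = p⊂q⇒∣p∣<∣q∣ (p⊆p∪q ⁅ b ⁆ , b , x∈p∪⁅x⁆ R b , b∉R)
      reach′ : ∀ {y} → y ∈ R′ → Reachable G u y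
      reach′ y∈R′ with x∈p∪⁅y⁆⁻ R b y∈R′
      ... | inj₁ y∈R = reach y∈R
      ... | inj₂ refl = reachable-snoc (reach a∈R) a~b
      grow′ : ∀ fuel → n ≤ fuel + ∣ R ∣ → ∃[ X ] (u ∈ X × Closed X × (∀ {y} → y ∈ X → Reachable G u y))
      grow′ zero    bound = contradiction bound (<⇒≱ (≤-trans R<R′ (∣p∣≤n R′)))
      grow′ (suc f) bound =
        grow f R′ (≤-trans bound (≤-trans (≤-reflexive (sym (+-suc f ∣ R ∣))) (+-monoʳ-≤ f R<R′)))
          (p⊆p∪q ⁅ b ⁆ u∈R) reach′

domNumber≡∣γ-set∣ : ∀ {H : Graph n} {k D} → DomNumber H k → GammaSet H D → k ≡ ∣ D ∣
domNumber≡∣γ-set∣ ((D′ , D′-dom , ∣D′∣≡k) , k-min) (D-dom , D-min) =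
  ≤-antisym (k-min _ D-dom) (≤-trans (D-min D′ D′-dom) (≤-reflexive ∣D′∣≡k))

module Deletion {m : ℕ} (G : Graph (suc m)) where
  open Neighbourhoods G

  -- A subset of V(G - v) viewed as a subset of V(G) avoiding v.
  lift : Fin (suc m) → Subset m → Subset (suc m)
  lift v T = insertAt T v outside

  v∉lift : ∀ v T → v ∉ lift v T
  v∉lift v T v∈ with trans (sym ([]=⇒lookup v∈)) (insertAt-lookup T v outside)
  ... | ()

  ∈lift⁺ : ∀ {v T i} → i ∈ T → punchIn v i ∈ lift v T
  ∈lift⁺ {v} {T} {i} = ∈-resp-lookup (sym (insertAt-punchIn T v outside i))

  ∈lift⁻ : ∀ {v T i} → punchIn v i ∈ lift v T → i ∈ T
  ∈lift⁻ {v} {T} {i} = ∈-resp-lookup (insertAt-punchIn T v outside i)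

  ∣lift∣ : ∀ v T → ∣ lift v T ∣ ≡ ∣ T ∣
  ∣lift∣ v T = ∣insertAt-outside∣ T v

  lift-removeAt : ∀ {v D} → v ∉ D → lift v (removeAt D v) ≡ D
  lift-removeAt {v} {D} v∉D =
    trans (cong (insertAt (removeAt D v) v) (sym (∉⇒lookup≡outside D v∉D))) (insertAt-removeAt D v)

  ∣removeAt∣ : ∀ {v D} → v ∉ D → ∣ removeAt D v ∣ ≡ ∣ D ∣
  ∣removeAt∣ {v} {D} v∉D = trans (sym (∣lift∣ v (removeAt D v))) (cong ∣_∣ (lift-removeAt v∉D))

  lift-dominates : ∀ {v T} → Dominating (G ─ v) T → DominatesExcept v (lift v T)
  lift-dominates {v} {T} dom u u≢v u∉lift
    with punchOut (u≢v ∘ sym) | punchIn-punchOut {i = v} (u≢v ∘ sym)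
  ... | i | refl with dom i (u∉lift ∘ ∈lift⁺)
  ...   | j , j∈T , i~j = punchIn v j , ∈lift⁺ j∈T , i~j

  lower-dominates : ∀ {v T} → DominatesExcept v (lift v T) → Dominating (G ─ v) T
  lower-dominates {v} {T} dom i i∉T with dom (punchIn v i) (punchInᵢ≢i v i) (i∉T ∘ ∈lift⁻)
  ... | w , w∈lift , i~w with v ≟ w
  ...   | yes refl = contradiction w∈lift (v∉lift v T)
  ...   | no  v≢w with punchOut v≢w | punchIn-punchOut v≢w
  ...     | j | refl = j , ∈lift⁻ w∈lift , i~w

  record DeletionGammaSet (v : Fin (suc m)) : Set where
    field
      set       : Subset (suc m)
      avoids    : v ∉ set
      dominates : DominatesExcept v set
      minimal   : ∀ D → v ∉ D → DominatesExcept v D → ∣ set ∣ ≤ ∣ D ∣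
      unique    : ∀ D → v ∉ D → DominatesExcept v D → ∣ D ∣ ≤ ∣ set ∣ → D ≡ set
      γ≡∣set∣   : ∀ {k} → DomNumber (G ─ v) k → k ≡ ∣ set ∣

  deletionGammaSet : ∀ {v} → UniqueGammaSet (G ─ v) → DeletionGammaSet v
  deletionGammaSet {v} (T , γ-T@(T-dom , T-min) , T-unique) = record
    { set       = lift v T
    ; avoids    = v∉lift v T
    ; dominates = lift-dominates T-dom
    ; minimal   = λ D v∉D D-dom → begin
        ∣ lift v T ∣          ≡⟨ ∣lift∣ v T ⟩
        ∣ T ∣                 ≤⟨ T-min _ (lower v∉D D-dom) ⟩
        ∣ removeAt D v ∣      ≡⟨ ∣removeAt∣ v∉D ⟩
        ∣ D ∣                 ∎
    ; unique    = λ D v∉D D-dom D≤ → trans (sym (lift-removeAt v∉D))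
        (cong (lift v) (T-unique _ (lower v∉D D-dom , λ D′ D′-dom → begin
          ∣ removeAt D v ∣    ≡⟨ ∣removeAt∣ v∉D ⟩
          ∣ D ∣               ≤⟨ D≤ ⟩
          ∣ lift v T ∣        ≡⟨ ∣lift∣ v T ⟩
          ∣ T ∣               ≤⟨ T-min D′ D′-dom ⟩
          ∣ D′ ∣              ∎)))
    ; γ≡∣set∣   = λ k-γ → trans (domNumber≡∣γ-set∣ {H = G ─ v} k-γ γ-T) (sym (∣lift∣ v T))
    }
    where
    open ≤-Reasoning
    lower : ∀ {D} → v ∉ D → DominatesExcept v D → Dominating (G ─ v) (removeAt D v)
    lower {D} v∉D D-dom = lower-dominates (subst (DominatesExcept v) (sym (lift-removeAt v∉D)) D-dom)

CoveredByTwo : ℕ → Set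
CoveredByTwo n = ∃[ a ] ∃[ b ] (∀ (y : Fin n) → y ≡ a ⊎ y ≡ b)

module Critical {m : ℕ} (G : Graph (suc m))
                (deleted : ∀ v → Deletion.DeletionGammaSet G v)
                {D₀ : Subset (suc m)} (γ-D₀ : GammaSet G D₀) where
  open Neighbourhoods G
  open Deletion.DeletionGammaSet

  private variable
    a b u v w z z′ ℓ ℓ′ : Fin (suc m)
    D D′ P Q T X : Subset (suc m)

  γ : ℕ
  γ = ∣ D₀ ∣

  γ-minimal : Dominating G D → γ ≤ ∣ D ∣
  γ-minimal dom = proj₂ γ-D₀ _ dom

  Optimal : Subset (suc m) → Set
  Optimal D = Dominating G D × ∣ D ∣ ≤ γ

  gammaSet⇒optimal : GammaSet G D → Optimal D
  gammaSet⇒optimal (dom , min) = dom , min D₀ (proj₁ γ-D₀)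

  S : Fin (suc m) → Subset (suc m)
  S v = set (deleted v)

  Critical NonCritical : Fin (suc m) → Set
  Critical v    = ∣ S v ∣ < γ
  NonCritical v = γ ≤ ∣ S v ∣

  critical-or-noncritical : ∀ v → Critical v ⊎ NonCritical v
  critical-or-noncritical v = Sum.swap (≤-<-connex γ ∣ S v ∣)

  critical⇒≢noncritical : Critical w → NonCritical u → w ≢ u
  critical⇒≢noncritical c nc refl = <⇒≱ c nc

  small-avoider≡S : NonCritical u → u ∉ D → DominatesExcept u D → ∣ D ∣ ≤ γ → D ≡ S u
  small-avoider≡S {u} nc u∉D dom ∣D∣≤γ = unique (deleted u) _ u∉D dom (≤-trans ∣D∣≤γ nc)

  optimal-avoiding-unique : NonCritical u → Optimal D → Optimal D′ → u ∉ D → u ∉ D′ → D ≡ D′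
  optimal-avoiding-unique {u} nc (dom , ∣D∣≤γ) (dom′ , ∣D′∣≤γ) u∉D u∉D′ =
    trans (small-avoider≡S nc u∉D (dominating⇒dominatesExcept u dom) ∣D∣≤γ)
          (sym (small-avoider≡S nc u∉D′ (dominating⇒dominatesExcept u dom′) ∣D′∣≤γ))

  avoided-twice⇒critical : Optimal D → Optimal D′ → D ≢ D′ → u ∉ D → u ∉ D′ → Critical u
  avoided-twice⇒critical {u = u} opt opt′ D≢D′ u∉D u∉D′ with critical-or-noncritical u
  ... | inj₁ c  = c
  ... | inj₂ nc = contradiction (optimal-avoiding-unique nc opt opt′ u∉D u∉D′) D≢D′

  critical-extend : Critical w → z ≡ w ⊎ w ~ z → Optimal (S w ∪ ⁅ z ⁆)
  critical-extend {w} {z} c z∈N[w] =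
    dominatesExcept⇒dominating w-dominated (dominatesExcept-mono (p⊆p∪q ⁅ z ⁆) (dominates (deleted w))) ,
    ≤-trans (∣p∪⁅x⁆∣≤1+∣p∣ (S w) z) c
    where
    w-dominated : w ∉ S w ∪ ⁅ z ⁆ → ∃[ v ] (v ∈ S w ∪ ⁅ z ⁆ × w ~ v)
    w-dominated w∉ = Sum.[ (λ { refl → contradiction (x∈p∪⁅x⁆ (S w) w) w∉ }) ,
                           (λ w~z → z , x∈p∪⁅x⁆ (S w) z , w~z) ] z∈N[w]

  critical⇒neighbour∉S : Critical w → w ~ z → z ∉ S w
  critical⇒neighbour∉S {w} {z} c w~z z∈S =
    <⇒≱ c (γ-minimal (dominatesExcept⇒dominating (λ _ → z , z∈S , w~z) (dominates (deleted w))))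

  -- Both S ℓ ∪ ⁅ ℓ ⁆ and S ℓ ∪ ⁅ z ⁆ are optimal and avoid u, so they coincide.
  critical-leaf : Critical ℓ → NonCritical u → ℓ ~ u → ℓ ~ z → z ≡ u
  critical-leaf {ℓ} {u} {z} c nc ℓ~u ℓ~z with z ≟ u
  ... | yes z≡u = z≡u
  ... | no  z≢u with x∈p∪⁅y⁆⁻ (S ℓ) z (subst (ℓ ∈_) A≡A′ (x∈p∪⁅x⁆ (S ℓ) ℓ))
    where
    u∉S = critical⇒neighbour∉S c ℓ~u
    A≡A′ = optimal-avoiding-unique nc (critical-extend c (inj₁ refl)) (critical-extend c (inj₂ ℓ~z))
             (x∉p∪⁅y⁆ (S ℓ) ℓ u∉S (~-irrefl ℓ~u ∘ sym)) (x∉p∪⁅y⁆ (S ℓ) z u∉S (z≢u ∘ sym))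
  ...   | inj₁ ℓ∈S = contradiction ℓ∈S (avoids (deleted ℓ))
  ...   | inj₂ ℓ≡z = contradiction ℓ≡z (~-irrefl ℓ~z)

  critical-neighbour-unique : NonCritical u → Critical ℓ → Critical ℓ′ → ℓ ~ u → ℓ′ ~ u → ℓ′ ≡ ℓ
  critical-neighbour-unique {u} {ℓ} {ℓ′} nc c c′ ℓ~u ℓ′~u with ℓ′ ≟ ℓ
  ... | yes ℓ′≡ℓ = ℓ′≡ℓ
  ... | no  ℓ′≢ℓ = contradiction (γ-minimal B-ℓ′-dom) (<⇒≱ (≤-trans (x∈p⇒∣p-x∣<∣p∣ ℓ′∈B) (proj₂ B-opt)))
    where
    A≡A′ : S ℓ ∪ ⁅ ℓ ⁆ ≡ S ℓ′ ∪ ⁅ ℓ′ ⁆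
    A≡A′ = optimal-avoiding-unique nc (critical-extend c (inj₁ refl)) (critical-extend c′ (inj₁ refl))
             (x∉p∪⁅y⁆ (S ℓ) ℓ (critical⇒neighbour∉S c ℓ~u) (~-irrefl ℓ~u ∘ sym))
             (x∉p∪⁅y⁆ (S ℓ′) ℓ′ (critical⇒neighbour∉S c′ ℓ′~u) (~-irrefl ℓ′~u ∘ sym))
    ℓ′∈S : ℓ′ ∈ S ℓ
    ℓ′∈S = Sum.[ id , (λ ℓ′≡ℓ → contradiction ℓ′≡ℓ ℓ′≢ℓ) ]′
             (x∈p∪⁅y⁆⁻ (S ℓ) ℓ (subst (ℓ′ ∈_) (sym A≡A′) (x∈p∪⁅x⁆ (S ℓ′) ℓ′)))
    B = S ℓ ∪ ⁅ u ⁆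
    B-opt = critical-extend c (inj₂ ℓ~u)
    ℓ′∈B = p⊆p∪q ⁅ u ⁆ ℓ′∈S
    u∈B-ℓ′ = x∈p∧x≢y⇒x∈p-y (x∈p∪⁅x⁆ (S ℓ) u) (~-irrefl ℓ′~u ∘ sym)
    B-ℓ′-dom : Dominating G (B - ℓ′)
    B-ℓ′-dom = dominatesExcept⇒dominating (λ u∉ → contradiction u∈B-ℓ′ u∉)
      (remove-dominates (dominating⇒dominatesExcept u (proj₁ B-opt)) (λ _ → u , u∈B-ℓ′ , ℓ′~u)
         λ v v≢u (_ , v~ℓ′ , _) → v≢u (critical-leaf c′ nc ℓ′~u (~-sym v~ℓ′)))

  noncritical⇒private-neighbour : NonCritical z → Optimal D → z ∈ D → ∃[ q ] Private D z q
  noncritical⇒private-neighbour {z} {D} nc (dom , ∣D∣≤γ) z∈D with any? (private? D z)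
  ... | yes found = found
  ... | no  none  = contradiction (minimal (deleted z) (D - z) (x∉p-x D z) D-z-dom)
                      (<⇒≱ (≤-trans (x∈p⇒∣p-x∣<∣p∣ z∈D) (≤-trans ∣D∣≤γ nc)))
    where
    D-z-dom = remove-dominates (dominating⇒dominatesExcept z dom) (λ z≢z → contradiction refl z≢z)
                λ u _ u-private → none (u , u-private)

  -- Were a ∈ S w, then b could be dropped from S w (if b ∈ S w) or could replace a (otherwise),
  -- contradicting the minimality or the uniqueness of S w.
  isolated-edge⇒∉S : a ~ b → (∀ {z} → a ~ z → z ≡ b) → (∀ {z} → b ~ z → z ≡ a) →
                     w ≢ a → w ≢ b → a ∉ S w
  isolated-edge⇒∉S {a} {b} {w} a~b a-leaf b-leaf w≢a w≢b a∈S with b ∈? S w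
  ... | yes b∈S = contradiction (minimal (deleted w) (S w - b) (avoids (deleted w) ∘ x∈p-y⇒x∈p) S-b-dom)
                    (<⇒≱ (x∈p⇒∣p-x∣<∣p∣ b∈S))
    where
    S-b-dom = remove-dominates (dominates (deleted w))
                (λ _ → a , x∈p∧x≢y⇒x∈p-y a∈S (~-irrefl a~b) , ~-sym a~b)
                λ u _ (u∉S , u~b , _) → u∉S (subst (_∈ S w) (sym (b-leaf (~-sym u~b))) a∈S)
  ... | no  b∉S = b∉S (subst (b ∈_) S′≡S (x∈p∪⁅x⁆ (S w - a) b))
    where
    S′≡S : (S w - a) ∪ ⁅ b ⁆ ≡ S w
    S′≡S = unique (deleted w) _ (x∉p∪⁅y⁆ (S w - a) b (avoids (deleted w) ∘ x∈p-y⇒x∈p) w≢b)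
             (swap-dominates (dominates (deleted w)) a~b λ u _ (_ , u~a , _) → inj₁ (a-leaf (~-sym u~a)))
             (∣p-x∪⁅y⁆∣≤∣p∣ (S w) b a∈S)

  module MixedEdge {x ℓ} (nc : NonCritical x) (c : Critical ℓ) (ℓ~x : ℓ ~ x) where

    A B : Subset (suc m)
    A = S ℓ ∪ ⁅ ℓ ⁆
    B = S ℓ ∪ ⁅ x ⁆

    A-opt : Optimal A
    A-opt = critical-extend c (inj₁ refl)

    B-opt : Optimal B
    B-opt = critical-extend c (inj₂ ℓ~x)

    x∉S : x ∉ S ℓ
    x∉S = critical⇒neighbour∉S c ℓ~x

    x∉A : x ∉ A
    x∉A = x∉p∪⁅y⁆ (S ℓ) ℓ x∉S (~-irrefl ℓ~x ∘ sym)

    x∈B : x ∈ B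
    x∈B = x∈p∪⁅x⁆ (S ℓ) x

    A≢B : A ≢ B
    A≢B A≡B = x∉A (subst (x ∈_) (sym A≡B) x∈B)

    ℓ-leaf : ℓ ~ z → z ≡ x
    ℓ-leaf = critical-leaf c nc ℓ~x

    noncritical-∈S : NonCritical u → u ≢ x → u ∈ S ℓ
    noncritical-∈S {u} nc-u u≢x with u ∈? S ℓ
    ... | yes u∈S = u∈S
    ... | no  u∉S = contradiction
          (optimal-avoiding-unique nc-u A-opt B-opt
             (x∉p∪⁅y⁆ (S ℓ) ℓ u∉S (critical⇒≢noncritical c nc-u ∘ sym)) (x∉p∪⁅y⁆ (S ℓ) x u∉S u≢x))
          A≢B

    -- Swapping u for its private neighbour q turns A into another small set avoiding x.
    noncritical-∉S : NonCritical u → u ∉ S ℓ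
    noncritical-∉S {u} nc-u u∈S with noncritical⇒private-neighbour nc-u B-opt (p⊆p∪q ⁅ x ⁆ u∈S)
    ... | q , q∉B , q~u , _ = q∉A (subst (q ∈_) A′≡A (x∈p∪⁅x⁆ (A - u) q))
      where
      u≢x : u ≢ x
      u≢x refl = x∉S u∈S
      q∉A : q ∉ A
      q∉A = x∉p∪⁅y⁆ (S ℓ) ℓ (q∉B ∘ p⊆p∪q ⁅ x ⁆) λ { refl → u≢x (ℓ-leaf q~u) }
      q-critical : Critical q
      q-critical = avoided-twice⇒critical A-opt B-opt A≢B q∉A q∉B
      privates-are-q : ∀ v → v ≢ x → Private A u v → v ≡ q ⊎ v ~ q
      privates-are-q v v≢x (v∉A , v~u , _) =
        inj₁ (critical-neighbour-unique nc-u q-critical v-critical q~u v~u)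
        where
        v-critical = avoided-twice⇒critical A-opt B-opt A≢B v∉A (x∉p∪⁅y⁆ (S ℓ) x (v∉A ∘ p⊆p∪q ⁅ ℓ ⁆) v≢x)
      A′≡A : (A - u) ∪ ⁅ q ⁆ ≡ A
      A′≡A = trans
        (small-avoider≡S nc (x∉p∪⁅y⁆ (A - u) q (x∉A ∘ x∈p-y⇒x∈p) λ { refl → q∉B x∈B })
           (swap-dominates (dominating⇒dominatesExcept x (proj₁ A-opt)) (~-sym q~u) privates-are-q)
           (≤-trans (∣p-x∪⁅y⁆∣≤∣p∣ A q (p⊆p∪q ⁅ ℓ ⁆ u∈S)) (proj₂ A-opt)))
        (sym (small-avoider≡S nc x∉A (dominating⇒dominatesExcept x (proj₁ A-opt)) (proj₂ A-opt)))

    noncritical≡x : NonCritical u → u ≡ x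
    noncritical≡x {u} nc-u with u ≟ x
    ... | yes u≡x = u≡x
    ... | no  u≢x = contradiction (noncritical-∈S nc-u u≢x) (noncritical-∉S nc-u)

    x-leaf : x ~ z → z ≡ ℓ
    x-leaf {z} x~z with critical-or-noncritical z
    ... | inj₁ c-z  = critical-neighbour-unique nc c c-z ℓ~x (~-sym x~z)
    ... | inj₂ nc-z = contradiction (sym (noncritical≡x nc-z)) (~-irrefl x~z)

    covers : ∀ y → y ≡ x ⊎ y ≡ ℓ
    covers y with y ≟ x | y ≟ ℓ
    ... | yes y≡x | _        = inj₁ y≡x
    ... | no  _   | yes y≡ℓ  = inj₂ y≡ℓ
    ... | no  y≢x | no  y≢ℓ
      with dominates (deleted y) x (y≢x ∘ sym) (isolated-edge⇒∉S (~-sym ℓ~x) x-leaf ℓ-leaf y≢x y≢ℓ)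
    ...   | z , z∈S , x~z = contradiction (subst (_∈ S y) (x-leaf x~z) z∈S)
                              (isolated-edge⇒∉S ℓ~x ℓ-leaf x-leaf y≢ℓ y≢x)

  -- Exchanging T and S w on a closed X gives two dominating sets whose sizes add up to ∣ S w ∣ + ∣ T ∣;
  -- the one avoiding w is then no larger than S w, hence equal to it.
  optimal-agrees-with-S : Closed X → w ∉ X → Optimal T → z ∈ X → lookup T z ≡ lookup (S w) z
  optimal-agrees-with-S {X} {w} {T} {z} closed w∉X (T-dom , ∣T∣≤γ) z∈X =
    trans (sym (select-inside X T (S w) z∈X)) (cong (λ D → lookup D z) mixed≡S)
    where
    mixed-dom : DominatesExcept w (select X T (S w))
    mixed-dom u u≢w u∉ = select-dominator closed u∉ (λ _ → T-dom u) (λ _ → dominates (deleted w) u u≢w)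
    other-dom : Dominating G (select X (S w) T)
    other-dom u u∉ = select-dominator closed u∉
      (λ u∈X → dominates (deleted w) u λ { refl → w∉X u∈X }) (λ _ → T-dom u)
    ∣T∣≤∣other∣ : ∣ T ∣ ≤ ∣ select X (S w) T ∣
    ∣T∣≤∣other∣ = ≤-trans ∣T∣≤γ (γ-minimal other-dom)
    mixed-small : ∣ select X T (S w) ∣ ≤ ∣ S w ∣
    mixed-small = +-cancelˡ-≤ ∣ select X (S w) T ∣ _ _ (begin
      ∣ select X (S w) T ∣ + ∣ select X T (S w) ∣ ≡⟨ ∣select∣+∣select∣ X (S w) T ⟩
      ∣ S w ∣ + ∣ T ∣                            ≤⟨ +-monoʳ-≤ ∣ S w ∣ ∣T∣≤∣other∣ ⟩
      ∣ S w ∣ + ∣ select X (S w) T ∣             ≡⟨ +-comm ∣ S w ∣ _ ⟩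
      ∣ select X (S w) T ∣ + ∣ S w ∣             ∎)
      where open ≤-Reasoning
    mixed≡S : select X T (S w) ≡ S w
    mixed≡S = unique (deleted w) _ (avoids (deleted w) ∘ ∈-resp-lookup (select-outside X T (S w) w∉X))
                mixed-dom mixed-small

  closed-cut⇒optimal-unique : Closed X → u ∈ X → w ∉ X → Optimal P → Optimal Q → P ≡ Q
  closed-cut⇒optimal-unique {X} {u} {w} {P} {Q} closed u∈X w∉X P-opt Q-opt =
    ⊆-antisym (λ {z} → ∈-resp-lookup (agree z)) (λ {z} → ∈-resp-lookup (sym (agree z)))
    where
    agree : ∀ z → lookup P z ≡ lookup Q z
    agree z with z ∈? X
    ... | yes z∈X = trans (optimal-agrees-with-S closed w∉X P-opt z∈X)
                          (sym (optimal-agrees-with-S closed w∉X Q-opt z∈X))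
    ... | no  z∉X = trans (optimal-agrees-with-S (∁-closed closed) u∉∁X P-opt (x∉p⇒x∈∁p z∉X))
                          (sym (optimal-agrees-with-S (∁-closed closed) u∉∁X Q-opt (x∉p⇒x∈∁p z∉X)))
      where
      u∉∁X = x∈p⇒x∉∁p u∈X

  connected : Optimal P → Optimal Q → P ≢ Q → Connected G
  connected P-opt Q-opt P≢Q u w with component u
  ... | X , u∈X , closed , reach with w ∈? X
  ...   | yes w∈X = reach w∈X
  ...   | no  w∉X = contradiction (closed-cut⇒optimal-unique closed u∈X w∉X P-opt Q-opt) P≢Q

  -- The private neighbours of the vertices of D₁ are distinct vertices of D₂.  If d ∈ D₁ ∖ D₂ had a
  -- second private neighbour r, not adjacent to its chosen one e, they would fit into D₂ - r;
  -- otherwise (D₁ - d) ∪ ⁅ e ⁆ is optimal, avoids d, hence equals D₂, which forces D₁ = ⁅ d ⁆.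
  module AllNonCritical (all-nc : ∀ v → NonCritical v) {D₁ D₂} (opt₁ : Optimal D₁) (opt₂ : Optimal D₂)
                        (D₁≢D₂ : D₁ ≢ D₂) where

    covers : ∀ u → u ∈ D₁ ⊎ u ∈ D₂
    covers u with u ∈? D₁ | u ∈? D₂
    ... | yes u∈D₁ | _        = inj₁ u∈D₁
    ... | no  _    | yes u∈D₂ = inj₂ u∈D₂
    ... | no  u∉D₁ | no  u∉D₂ =
          contradiction (all-nc u) (<⇒≱ (avoided-twice⇒critical opt₁ opt₂ D₁≢D₂ u∉D₁ u∉D₂))

    f : Fin (suc m) → Fin (suc m)
    f z with z ∈? D₁
    ... | yes z∈D₁ = proj₁ (noncritical⇒private-neighbour (all-nc z) opt₁ z∈D₁)
    ... | no  _    = z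

    f-private : z ∈ D₁ → Private D₁ z (f z)
    f-private {z} z∈D₁ with z ∈? D₁
    ... | yes z∈D₁′ = proj₂ (noncritical⇒private-neighbour (all-nc z) opt₁ z∈D₁′)
    ... | no  z∉D₁  = contradiction z∈D₁ z∉D₁

    f-injective : z ∈ D₁ → z′ ∈ D₁ → f z ≡ f z′ → z ≡ z′
    f-injective {z′ = z′} z∈D₁ z′∈D₁ fz≡fz′ =
      private-unique (f-private z∈D₁) (subst (Private D₁ z′) (sym fz≡fz′) (f-private z′∈D₁)) z∈D₁

    f∈D₂ : z ∈ D₁ → f z ∈ D₂
    f∈D₂ {z} z∈D₁ = Sum.[ (λ fz∈D₁ → contradiction fz∈D₁ (proj₁ (f-private z∈D₁))) , id ]′ (covers (f z))

    difference : ∃[ d ] (d ∈ D₁ × d ∉ D₂)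
    difference = ∣q∣≤∣p∣∧p≢q⇒∃p-q (≤-trans (proj₂ opt₂) (γ-minimal (proj₁ opt₁))) D₁≢D₂

    d : Fin (suc m)
    d = proj₁ difference

    d∈D₁ : d ∈ D₁
    d∈D₁ = proj₁ (proj₂ difference)

    e : Fin (suc m)
    e = f d

    e-private : Private D₁ d e
    e-private = f-private d∈D₁

    covered : CoveredByTwo (suc m)
    covered with any? (λ r → ¬? (r ≟ e) ×-dec private? D₁ d r ×-dec ¬? (r ~? e))
    ... | yes (r , r≢e , r-private , _) =
          contradiction (≤-trans (proj₂ opt₂) (γ-minimal (proj₁ opt₁)))
            (<⇒≱ (≤-<-trans (injection⇒∣p∣≤∣q∣ D₁ f f∈D₂-r f-injective) (x∈p⇒∣p-x∣<∣p∣ r∈D₂)))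
      where
      r∈D₂ : r ∈ D₂
      r∈D₂ = Sum.[ (λ r∈D₁ → contradiction r∈D₁ (proj₁ r-private)) , id ]′ (covers r)
      f∈D₂-r : z ∈ D₁ → f z ∈ D₂ - r
      f∈D₂-r {z} z∈D₁ = x∈p∧x≢y⇒x∈p-y (f∈D₂ z∈D₁) λ fz≡r →
        let z≡d = private-unique (subst (Private D₁ z) fz≡r (f-private z∈D₁)) r-private z∈D₁
        in r≢e (trans (sym fz≡r) (cong f z≡d))
    ... | no none = d , e , covers′
      where
      D₁′ = (D₁ - d) ∪ ⁅ e ⁆
      near-e : ∀ u → u ≢ e → Private D₁ d u → u ≡ e ⊎ u ~ e
      near-e u u≢e u-private with u ~? e
      ... | yes u~e = inj₂ u~e
      ... | no  u≁e = contradiction (u , u≢e , u-private , u≁e) none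
      D₁′-dom : Dominating G D₁′
      D₁′-dom = dominatesExcept⇒dominating (λ e∉ → contradiction (x∈p∪⁅x⁆ (D₁ - d) e) e∉)
                  (swap-dominates (dominating⇒dominatesExcept e (proj₁ opt₁))
                     (~-sym (proj₁ (proj₂ e-private))) near-e)
      D₁′≡D₂ : D₁′ ≡ D₂
      D₁′≡D₂ = optimal-avoiding-unique (all-nc d)
                 (D₁′-dom , ≤-trans (∣p-x∪⁅y⁆∣≤∣p∣ D₁ e d∈D₁) (proj₂ opt₁)) opt₂
                 (x∉p∪⁅y⁆ (D₁ - d) e (x∉p-x D₁ d) λ d≡e → proj₁ e-private (subst (_∈ D₁) d≡e d∈D₁))
                 (proj₂ (proj₂ difference))
      D₁⊆⁅d⁆ : z ∈ D₁ → z ≡ d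
      D₁⊆⁅d⁆ {z} z∈D₁ with x∈p∪⁅y⁆⁻ (D₁ - d) e (subst (f z ∈_) (sym D₁′≡D₂) (f∈D₂ z∈D₁))
      ... | inj₁ fz∈D₁-d = contradiction (x∈p-y⇒x∈p fz∈D₁-d) (proj₁ (f-private z∈D₁))
      ... | inj₂ fz≡e    = f-injective z∈D₁ d∈D₁ fz≡e
      covers′ : ∀ y → y ≡ d ⊎ y ≡ e
      covers′ y with covers y
      ... | inj₁ y∈D₁ = inj₁ (D₁⊆⁅d⁆ y∈D₁)
      ... | inj₂ y∈D₂ = Sum.map₁ (D₁⊆⁅d⁆ ∘ x∈p-y⇒x∈p) (x∈p∪⁅y⁆⁻ (D₁ - d) e (subst (y ∈_) (sym D₁′≡D₂) y∈D₂))

  mixed-walk⇒coveredByTwo : NonCritical u → Critical w → Reachable G u w → CoveredByTwo (suc m)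
  mixed-walk⇒coveredByTwo nc c here = contradiction nc (<⇒≱ c)
  mixed-walk⇒coveredByTwo nc c (step {w = v} u~v walk) with critical-or-noncritical v
  ... | inj₁ c-v  = _ , _ , MixedEdge.covers nc c-v (~-sym u~v)
  ... | inj₂ nc-v = mixed-walk⇒coveredByTwo nc-v c walk

  noncritical⇒coveredByTwo : Connected G → Optimal P → Optimal Q → P ≢ Q → NonCritical u →
                             CoveredByTwo (suc m)
  noncritical⇒coveredByTwo {u = u} conn P-opt Q-opt P≢Q nc with any? (λ w → ∣ S w ∣ <? γ)
  ... | yes (w , c) = mixed-walk⇒coveredByTwo nc c (conn u w)
  ... | no  none    = AllNonCritical.covered (λ v → ≮⇒≥ (λ c → none (v , c))) P-opt Q-opt P≢Q

  critical⇒2≤γ : Critical v → u ≢ v → 2 ≤ γ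
  critical⇒2≤γ {v} {u} c u≢v with u ∈? S v
  ... | yes u∈S = ≤-trans (s≤s (x∈p⇒1≤∣p∣ u∈S)) c
  ... | no  u∉S = ≤-trans (s≤s (x∈p⇒1≤∣p∣ (proj₁ (proj₂ (dominates (deleted v) u u≢v u∉S))))) c

  all-critical⇒VC : (∀ v → Critical v) → VC G
  all-critical⇒VC all-c v k k′ k-γ k′-γ =
    subst₂ _<_ (sym (γ≡∣set∣ (deleted v) k′-γ)) (sym (domNumber≡∣γ-set∣ {H = G} k-γ γ-D₀)) (all-c v)

¬coveredByTwo : ¬ CoveredByTwo (suc (suc (suc n)))
¬coveredByTwo (a , b , cover) with cover zero | cover (suc zero) | cover (suc (suc zero))
... | inj₁ refl | inj₁ ()   | _
... | inj₂ refl | inj₂ ()   | _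
... | inj₁ refl | inj₂ refl | inj₁ ()
... | inj₁ refl | inj₂ refl | inj₂ ()
... | inj₂ refl | inj₁ refl | inj₁ ()
... | inj₂ refl | inj₁ refl | inj₂ ()

twoGammaSets⇒edge : (G : Graph n) → TwoGammaSets G → ∃[ u ] ∃[ w ] (Adj G u w ≡ true)
twoGammaSets⇒edge G (D₁ , D₂ , (dom₁ , _) , (dom₂ , _) , D₁≢D₂)
  with any? (λ u → any? (λ w → Adj G u w ≟ᵇ true))
... | yes edge = edge
... | no  none = contradiction (⊆-antisym (λ _ → all-in dom₂) (λ _ → all-in dom₁)) D₁≢D₂
  where
  all-in : ∀ {D} → Dominating G D → ∀ {u} → u ∈ D
  all-in {D} dom {u} with u ∈? D
  ... | yes u∈D = u∈D
  ... | no  u∉D with dom u u∉D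
  ...   | w , _ , u~w = contradiction (u , w , u~w) none

edge⇒2≤n : (G : Graph n) → ∃[ u ] ∃[ w ] (Adj G u w ≡ true) → 2 ≤ n
edge⇒2≤n {suc zero}    G (zero , zero , 0~0) = contradiction refl (Neighbourhoods.~-irrefl G 0~0)
edge⇒2≤n {suc (suc n)} G _                   = s≤s (s≤s z≤n)

module _ (G : Graph 2) where
  open Neighbourhoods G

  edge⇒K₂ : ∃[ u ] ∃[ w ] (u ~ w) → IsK₂ G
  edge⇒K₂ (zero     , zero     , 0~0) = contradiction refl (~-irrefl 0~0)
  edge⇒K₂ (zero     , suc zero , 0~1) =
    refl , λ { zero zero 0≢0 → contradiction refl 0≢0 ; zero (suc zero) _ → 0~1
             ; (suc zero) zero _ → ~-sym 0~1 ; (suc zero) (suc zero) 1≢1 → contradiction refl 1≢1 }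
  edge⇒K₂ (suc zero , zero     , 1~0) = edge⇒K₂ (zero , suc zero , ~-sym 1~0)
  edge⇒K₂ (suc zero , suc zero , 1~1) = contradiction refl (~-irrefl 1~1)

module _ (G : Graph 3) where
  open Neighbourhoods G

  connected₃⇒dominating-vertex : Connected G → ∃[ c ] Dominating G ⁅ c ⁆
  connected₃⇒dominating-vertex conn
    with Adj G zero (suc zero) in e₀₁ | Adj G zero (suc (suc zero)) in e₀₂
       | Adj G (suc zero) (suc (suc zero)) in e₁₂
  ... | true  | true  | _     = zero , universal⇒dominating λ
          { zero 0≢0 → contradiction refl 0≢0 ; (suc zero) _ → ~-sym e₀₁ ; (suc (suc zero)) _ → ~-sym e₀₂ }
  ... | true  | false | true  = suc zero , universal⇒dominating λ
          { zero _ → e₀₁ ; (suc zero) 1≢1 → contradiction refl 1≢1 ; (suc (suc zero)) _ → ~-sym e₁₂ }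
  ... | false | true  | true  = suc (suc zero) , universal⇒dominating λ
          { zero _ → e₀₂ ; (suc zero) _ → e₁₂ ; (suc (suc zero)) 2≢2 → contradiction refl 2≢2 }
  ... | false | false | _     = ⊥-elim (isolated⇒unreachable (λ ())
          (λ { zero → irrefl G zero ; (suc zero) → e₀₁ ; (suc (suc zero)) → e₀₂ }) (conn zero (suc zero)))
  ... | true  | false | false = ⊥-elim (isolated⇒unreachable (λ ())
          (λ { zero → trans (Graph.sym G _ _) e₀₂ ; (suc zero) → trans (Graph.sym G _ _) e₁₂
             ; (suc (suc zero)) → irrefl G _ }) (conn (suc (suc zero)) zero))
  ... | false | true  | false = ⊥-elim (isolated⇒unreachable (λ ())
          (λ { zero → trans (Graph.sym G _ _) e₀₁ ; (suc zero) → irrefl G _ ; (suc (suc zero)) → e₁₂ })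
          (conn (suc zero) zero))

hypoUD⇒connected-vc : (G : Graph (suc (suc (suc n)))) → HypoUD G →
                      Connected G × VC G × (∀ D → Dominating G D → 2 ≤ ∣ D ∣)
hypoUD⇒connected-vc G ((D₁ , D₂ , γ₁ , γ₂ , D₁≢D₂) , deletions) =
  conn , all-critical⇒VC all-critical ,
  λ D dom → ≤-trans (critical⇒2≤γ {v = zero} {u = suc zero} (all-critical zero) λ ()) (γ-minimal dom)
  where
  open Critical G (λ v → Deletion.deletionGammaSet G (deletions v)) γ₁
  opt₁ = gammaSet⇒optimal γ₁
  opt₂ = gammaSet⇒optimal γ₂
  conn : Connected G
  conn = connected opt₁ opt₂ D₁≢D₂
  all-critical : ∀ v → Critical v
  all-critical v with critical-or-noncritical v
  ... | inj₁ c  = c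
  ... | inj₂ nc = contradiction (noncritical⇒coveredByTwo {u = v} conn opt₁ opt₂ D₁≢D₂ nc) ¬coveredByTwo

theorem3p1 : ∀ {n : ℕ} (G : Graph n) → HypoUD G
    → IsK₂ G ⊎ (Connected G × VC G × 4 ≤ n)
theorem3p1 {0} G (two , _) = contradiction (edge⇒2≤n G (twoGammaSets⇒edge G two)) λ ()
theorem3p1 {1} G (two , _) = contradiction (edge⇒2≤n G (twoGammaSets⇒edge G two)) λ { (s≤s ()) }
theorem3p1 {2} G (two , _) = inj₁ (edge⇒K₂ G (twoGammaSets⇒edge G two))
theorem3p1 {3} G hypoUD with hypoUD⇒connected-vc G hypoUD
... | conn , _ , γ≥2 with connected₃⇒dominating-vertex G conn
...   | c , ⁅c⁆-dom = contradiction (≤-trans (γ≥2 ⁅ c ⁆ ⁅c⁆-dom) (≤-reflexive (∣⁅x⁆∣≡1 c))) λ { (s≤s ()) }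
theorem3p1 {suc (suc (suc (suc n)))} G hypoUD with hypoUD⇒connected-vc G hypoUD
... | conn , vc , _ = inj₂ (conn , vc , s≤s (s≤s (s≤s (s≤s z≤n))))
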